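{- Let $G$ be a complete graph, $f_0,f_t$ token-placements of $G$ with color set $\{1,\dots,c\}$, and $\mathcal{C}^*$ an optimal cycle cover of the destination graph $D(f_0,f_t)$. Then every cycle $A\in\mathcal{C}^*$ contains at most $c$ vertices.
   Context: A token-placement of $G=(V,E)$ is a surjective map $V\to\{1,\dots,c\}$. The destination graph $D(f_0,f_t)$ is the directed graph on $V$ with an arc $(u,v)$ (self-loops allowed) iff $f_0(u)=f_t(v)$. A cycle cover is a set of vertex-disjoint directed cycles of $D(f_0,f_t)$ (self-loops count as one-vertex cycles) covering all vertices; it is optimal if it has the maximum number of cycles among all cycle covers of $D(f_0,f_t)$. -}

module Defs where

open import Data.Nat using (ℕ)
open import Data.Fin using (Fin)
open import Data.List using (List; []; _∷_; _++_; concat; length)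
open import Data.List.Relation.Unary.Linked using (Linked)
open import Data.List.Relation.Unary.Unique.Propositional using (Unique)
open import Data.List.Relation.Binary.Permutation.Propositional using (_↭_)
open import Data.Fin.Base using ()
open import Data.List using (allFin)
open import Data.Product using (∃; _×_)
open import Data.Empty using (⊥)
open import Relation.Binary.PropositionalEquality using (_≡_)

-- The vertex set of the graph G (complete graph K_n) is Fin n; colors are Fin c.

IsTokenPlacement : {n c : ℕ} → (Fin n → Fin c) → Set
IsTokenPlacement {n} {c} f = ∀ (y : Fin c) → ∃ λ (x : Fin n) → f x ≡ y

Arc : {n c : ℕ} → (f₀ fₜ : Fin n → Fin c) → Fin n → Fin n → Set
Arc f₀ fₜ u v = f₀ u ≡ fₜ v

-- A directed cycle of D, given by its vertex sequence v₁ … v_k (k ≥ 1):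
-- vertices pairwise distinct, arcs vᵢ → vᵢ₊₁ and v_k → v₁
-- (for k = 1 this is a self-loop).
IsCycle : {n c : ℕ} → (f₀ fₜ : Fin n → Fin c) → List (Fin n) → Set
IsCycle f₀ fₜ [] = ⊥
IsCycle f₀ fₜ (x ∷ xs) = Unique (x ∷ xs) × Linked (Arc f₀ fₜ) (x ∷ xs ++ x ∷ [])

data AllCycles {n c : ℕ} (f₀ fₜ : Fin n → Fin c) : List (List (Fin n)) → Set where
  []  : AllCycles f₀ fₜ []
  _∷_ : ∀ {A 𝒞} → IsCycle f₀ fₜ A → AllCycles f₀ fₜ 𝒞 → AllCycles f₀ fₜ (A ∷ 𝒞)

-- A cycle cover: a collection of directed cycles of D that are vertex-disjoint
-- and cover all vertices, i.e. every vertex occurs exactly once overall.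
IsCycleCover : {n c : ℕ} → (f₀ fₜ : Fin n → Fin c) → List (List (Fin n)) → Set
IsCycleCover {n} f₀ fₜ 𝒞 = AllCycles f₀ fₜ 𝒞 × (concat 𝒞 ↭ allFin n)

numCycles : {A : Set} → List (List A) → ℕ
numCycles = length

IsOptimalCycleCover : {n c : ℕ} → (f₀ fₜ : Fin n → Fin c) → List (List (Fin n)) → Set
IsOptimalCycleCover {n} f₀ fₜ 𝒞 =
  IsCycleCover f₀ fₜ 𝒞 ×
  (∀ (𝒞′ : List (List (Fin n))) → IsCycleCover f₀ fₜ 𝒞′ → numCycles 𝒞′ Data.Nat.≤ numCycles 𝒞)

{-# OPTIONS --safe #-}
-- A cycle with more than c vertices contains, by pigeonhole, two vertices a and b
-- with f₀ a = f₀ b, so a and b have the same out-neighbours in D(f₀,fₜ).  Exchanging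
-- the arcs leaving a and b splits the cycle P a Q b R into the two cycles b Q and
-- P a R on the same vertices, and the resulting cover has one cycle more.
module Submission where

open import Defs
open import Data.Nat using (ℕ; _≤_; _<_; s<s)
open import Data.Nat.Properties using (≮⇒≥; 1+n≰n; ≤-trans; ≤-reflexive)
open import Data.Fin using (Fin; zero; suc)
import Data.Fin as Fin
open import Data.Fin.Properties using (pigeonhole)
open import Data.List using (List; []; _∷_; _++_; [_]; concat; length; lookup; allFin)
open import Data.List.Properties using (++-assoc; concat-++; length-++-sucʳ)
open import Data.List.Membership.Propositional using (_∈_)
open import Data.List.Membership.Propositional.Properties using (∈-∃++; ∈-lookup)
open import Data.List.Relation.Unary.Any using (here; there)
open import Data.List.Relation.Unary.Linked using (Linked; [-]; _∷_)
open import Data.List.Relation.Unary.All.Properties using () renaming (++⁻ˡ to All-++⁻ˡ)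
open import Data.List.Relation.Unary.Unique.Propositional using (Unique; []; _∷_)
open import Data.List.Relation.Binary.Permutation.Propositional
  using (_↭_; ↭-sym; ↭-prep; ↭-swap; ↭-trans; ↭-refl; ↭⇒↭ₛ; module PermutationReasoning)
open import Data.List.Relation.Binary.Permutation.Propositional.Properties
  using (shift; shifts; ++⁺ʳ; ++⁺ˡ)
import Data.List.Relation.Binary.Permutation.Setoid.Properties as PermutationSetoid
open import Data.Empty using (⊥)
open import Data.Product using (∃; ∃₂; _×_; _,_)
open import Relation.Binary.PropositionalEquality using (_≡_; refl; sym; trans; cong; subst; setoid)

module _ {A : Set} where

  Unique-resp-↭ : {xs ys : List A} → xs ↭ ys → Unique xs → Unique ys
  Unique-resp-↭ p = PermutationSetoid.Unique-resp-↭ (setoid A) (↭⇒↭ₛ p)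

  Unique-++⁻ : ∀ (xs : List A) {ys} → Unique (xs ++ ys) → Unique xs × Unique ys
  Unique-++⁻ []       u        = [] , u
  Unique-++⁻ (x ∷ xs) (x∉ ∷ u) = let uxs , uys = Unique-++⁻ xs u in All-++⁻ˡ xs x∉ ∷ uxs , uys

  exchange-↭ : ∀ (P : List A) a Q b R → P ++ a ∷ Q ++ b ∷ R ↭ (b ∷ Q) ++ (P ++ a ∷ R)
  exchange-↭ P a Q b R = ↭-trans (++⁺ˡ P swap-ends) (shifts P (b ∷ Q))
    where
    swap-ends : a ∷ Q ++ b ∷ R ↭ b ∷ Q ++ a ∷ R
    swap-ends = ↭-trans (↭-prep a (shift b Q R))
                  (↭-trans (↭-swap a b ↭-refl) (↭-prep b (↭-sym (shift a Q R))))

  exchange-Unique : ∀ (P : List A) {a} Q {b} R → Unique (P ++ a ∷ Q ++ b ∷ R) →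
                    Unique (b ∷ Q) × Unique (P ++ a ∷ R)
  exchange-Unique P {a} Q {b} R u = Unique-++⁻ (b ∷ Q) (Unique-resp-↭ (exchange-↭ P a Q b R) u)

  splitAtIndices : ∀ (xs : List A) {i j : Fin (length xs)} → i Fin.< j →
                   ∃₂ λ P Q → ∃ λ R → xs ≡ P ++ lookup xs i ∷ Q ++ lookup xs j ∷ R
  splitAtIndices (x ∷ xs) {zero} {suc j} _ =
    let Q , R , xs≡ = ∈-∃++ (∈-lookup j) in [] , Q , R , cong (x ∷_) xs≡
  splitAtIndices (x ∷ xs) {suc i} {suc j} (s<s i<j) =
    let P , Q , R , xs≡ = splitAtIndices xs i<j in x ∷ P , Q , R , cong (x ∷_) xs≡

  collision : ∀ {c} (f : A → Fin c) (xs : List A) → c < length xs →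
              ∃₂ λ P a → ∃₂ λ Q b → ∃ λ R → xs ≡ P ++ a ∷ Q ++ b ∷ R × f a ≡ f b
  collision f xs c<|xs| =
    let i , j , i<j , fi≡fj = pigeonhole c<|xs| (λ k → f (lookup xs k))
        P , Q , R , xs≡ = splitAtIndices xs i<j
    in P , _ , Q , _ , R , xs≡ , fi≡fj

module _ {V : Set} (_⟶_ : V → V → Set) where

  Walk : V → List V → V → Set
  Walk a xs b = Linked _⟶_ (a ∷ xs ++ [ b ])

  Walk-split : ∀ xs {a m ys b} → Walk a (xs ++ m ∷ ys) b → Walk a xs m × Walk m ys b
  Walk-split []       (a⟶m ∷ w) = a⟶m ∷ [-] , w
  Walk-split (x ∷ xs) (a⟶x ∷ w) = let w₁ , w₂ = Walk-split xs w in a⟶x ∷ w₁ , w₂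

  Walk-++ : ∀ xs {a m ys b} → Walk a xs m → Walk m ys b → Walk a (xs ++ m ∷ ys) b
  Walk-++ []       (a⟶m ∷ [-]) w₂ = a⟶m ∷ w₂
  Walk-++ (x ∷ xs) (a⟶x ∷ w₁)  w₂ = a⟶x ∷ Walk-++ xs w₁ w₂

  Walk-fromSource : ∀ {a a′ xs b} → (∀ {v} → a ⟶ v → a′ ⟶ v) → Walk a xs b → Walk a′ xs b
  Walk-fromSource {xs = []}    h (a⟶b ∷ w) = h a⟶b ∷ w
  Walk-fromSource {xs = _ ∷ _} h (a⟶x ∷ w) = h a⟶x ∷ w

  Walk-exchange : ∀ Q {a b R z} → (∀ {v} → a ⟶ v → b ⟶ v) → (∀ {v} → b ⟶ v → a ⟶ v) →
                  Walk a (Q ++ b ∷ R) z → Walk b Q b × Walk a R z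
  Walk-exchange Q a⇒b b⇒a w =
    let w₁ , w₂ = Walk-split Q w in Walk-fromSource a⇒b w₁ , Walk-fromSource b⇒a w₂

module _ {n c : ℕ} {f₀ fₜ : Fin n → Fin c} where

  IsCycle-split : ∀ P {a} Q {b} R → f₀ a ≡ f₀ b → IsCycle f₀ fₜ (P ++ a ∷ Q ++ b ∷ R) →
                  IsCycle f₀ fₜ (b ∷ Q) × IsCycle f₀ fₜ (P ++ a ∷ R)
  IsCycle-split [] Q R fa≡fb (u , w) =
    let uQ , uR = exchange-Unique [] Q R u
        wQ , wR = Walk-exchange (Arc f₀ fₜ) Q (trans (sym fa≡fb)) (trans fa≡fb) w
    in (uQ , wQ) , (uR , wR)
  IsCycle-split (x ∷ P) Q R fa≡fb (u , w) =
    let uQ , uPR = exchange-Unique (x ∷ P) Q R u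
        wP , w′ = Walk-split (Arc f₀ fₜ) P w
        wQ , wR = Walk-exchange (Arc f₀ fₜ) Q (trans (sym fa≡fb)) (trans fa≡fb) w′
    in (uQ , wQ) , (uPR , Walk-++ (Arc f₀ fₜ) P wP wR)

  AllCycles-∈ : ∀ {𝒞 A} → AllCycles f₀ fₜ 𝒞 → A ∈ 𝒞 → IsCycle f₀ fₜ A
  AllCycles-∈ (cA ∷ _)  (here refl) = cA
  AllCycles-∈ (_ ∷ all) (there A∈𝒞) = AllCycles-∈ all A∈𝒞

  AllCycles-remove : ∀ 𝒳 {A 𝒴} → AllCycles f₀ fₜ (𝒳 ++ A ∷ 𝒴) → AllCycles f₀ fₜ (𝒳 ++ 𝒴)
  AllCycles-remove []      (_ ∷ all)  = all
  AllCycles-remove (_ ∷ 𝒳) (cX ∷ all) = cX ∷ AllCycles-remove 𝒳 all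

  IsCycleCover-refine : ∀ 𝒳 {A B C 𝒴} → IsCycleCover f₀ fₜ (𝒳 ++ A ∷ 𝒴) → A ↭ B ++ C →
                        IsCycle f₀ fₜ B → IsCycle f₀ fₜ C → IsCycleCover f₀ fₜ (B ∷ C ∷ 𝒳 ++ 𝒴)
  IsCycleCover-refine 𝒳 {A} {B} {C} {𝒴} (all , covers) A↭B++C cB cC =
    cB ∷ cC ∷ AllCycles-remove 𝒳 all , (begin
      B ++ C ++ concat (𝒳 ++ 𝒴)     ≡⟨ ++-assoc B C _ ⟨
      (B ++ C) ++ concat (𝒳 ++ 𝒴)   ↭⟨ ++⁺ʳ _ (↭-sym A↭B++C) ⟩
      A ++ concat (𝒳 ++ 𝒴)          ≡⟨ cong (A ++_) (concat-++ 𝒳 𝒴) ⟨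
      A ++ concat 𝒳 ++ concat 𝒴     ↭⟨ shifts A (concat 𝒳) ⟩
      concat 𝒳 ++ A ++ concat 𝒴     ≡⟨ concat-++ 𝒳 (A ∷ 𝒴) ⟩
      concat (𝒳 ++ A ∷ 𝒴)           ↭⟨ covers ⟩
      allFin n                       ∎)
    where open PermutationReasoning

  IsOptimalCycleCover⇒unsplittable : ∀ {𝒞 A B C} → IsOptimalCycleCover f₀ fₜ 𝒞 → A ∈ 𝒞 →
                                     A ↭ B ++ C → IsCycle f₀ fₜ B → IsCycle f₀ fₜ C → ⊥
  IsOptimalCycleCover⇒unsplittable {A = A} (cover , maximal) A∈𝒞 A↭B++C cB cC
    with 𝒳 , 𝒴 , refl ← ∈-∃++ A∈𝒞 =
    1+n≰n (≤-trans (maximal _ (IsCycleCover-refine 𝒳 cover A↭B++C cB cC))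
                   (≤-reflexive (length-++-sucʳ 𝒳 A 𝒴)))

lemma5 : (n c : ℕ) (f₀ fₜ : Fin n → Fin c) →
         IsTokenPlacement f₀ → IsTokenPlacement fₜ →
         (𝒞 : List (List (Fin n))) → IsOptimalCycleCover f₀ fₜ 𝒞 →
         ∀ (A : List (Fin n)) → A ∈ 𝒞 → length A ≤ c
lemma5 n c f₀ fₜ _ _ 𝒞 optimal@((cycles , _) , _) A A∈𝒞 = ≮⇒≥ λ c<|A| →
  let P , a , Q , b , R , A≡ , fa≡fb = collision f₀ A c<|A|
      cycle = subst (IsCycle f₀ fₜ) A≡ (AllCycles-∈ cycles A∈𝒞)
      cQ , cPaR = IsCycle-split P Q R fa≡fb cycle
  in IsOptimalCycleCover⇒unsplittable optimal A∈𝒞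
       (subst (_↭ (b ∷ Q) ++ (P ++ a ∷ R)) (sym A≡) (exchange-↭ P a Q b R)) cQ cPaR
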